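{- If a graph $G$ is $\mathbb{Z}_3$-colorable, then $G$ is $\mathbb{Z}_5$-colorable.
   Context: Graphs may have multiple edges but no loops. For an Abelian group $\Gamma$, a graph $G$ is $\Gamma$-colorable if, for some orientation $D$ of $G$ (equivalently, for every orientation) and for every function $\varphi:E(G)\to\Gamma$, there is a map $c:V(G)\to\Gamma$ with $c(w)-c(u)\neq\varphi(uw)$ for every directed edge $uw$ of $D$. -}

module Defs where

open import Data.Nat using (ℕ; suc; _+_; _∸_; NonZero)
open import Data.Nat.DivMod using (_%_)
open import Data.Fin using (Fin; toℕ; fromℕ<)
open import Data.Nat.DivMod using (m%n<n)
open import Data.Bool using (Bool; true; false)
open import Data.Product using (Σ; _×_; _,_; proj₁; proj₂)
open import Relation.Binary.PropositionalEquality using (_≡_)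
open import Relation.Nullary using (¬_)

ℤ/_ : ℕ → Set
ℤ/ k = Fin k

sub : ∀ {k} → Fin (suc k) → Fin (suc k) → Fin (suc k)
sub {k} a b = fromℕ< (m%n<n (toℕ a + (suc k ∸ toℕ b)) (suc k))

-- A (loopless) multigraph on vertex set Fin n with m edges; edge e has
-- endpoints (end₁ e , end₂ e), which are distinct.  Parallel edges allowed.
record Graph : Set where
  field
    n     : ℕ
    m     : ℕ
    end₁  : Fin m → Fin n
    end₂  : Fin m → Fin n
    loopless : ∀ e → ¬ (end₁ e ≡ end₂ e)

open Graph public

Orientation : Graph → Set
Orientation G = Fin (m G) → Bool

tail head : (G : Graph) → Orientation G → Fin (m G) → Fin (n G)
tail G D e with D e
... | true  = end₁ G e
... | false = end₂ G e
head G D e with D e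
... | true  = end₂ G e
... | false = end₁ G e

-- G is ℤ_(suc k)-colorable: for some orientation D and every φ : E(G) → Γ
-- there is c : V(G) → Γ with c(w) - c(u) ≠ φ(uw) for every arc uw of D.
Colorable : ℕ → Graph → Set
Colorable k G =
  Σ (Orientation G) λ D →
    (φ : Fin (m G) → Fin (suc k)) →
      Σ (Fin (n G) → Fin (suc k)) λ c →
        ∀ e → ¬ (sub (c (head G D e)) (c (tail G D e)) ≡ φ e)

Z3-colorable Z5-colorable : Graph → Set
Z3-colorable = Colorable 2
Z5-colorable = Colorable 4

-- Color with ℤ₃ ⊂ ℤ₅ (as 0, 1, 2). Differences of such colors lie in {0, ±1, ±2},
-- and reducing the representative in {-2, …, 2} modulo 3 recovers the difference in ℤ₃.
-- So, given φ : E → ℤ₅, color G against the reduced φ in ℤ₃ and embed the coloring: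
-- an edge conflict in ℤ₅ would reduce to an edge conflict in ℤ₃.
module Submission where

open import Defs
open import Data.Nat using (suc)
open import Data.Fin using (Fin; zero; suc)
open import Data.Product using (_,_)
open import Relation.Binary.PropositionalEquality using (_≡_; refl; trans; cong)

colorable-transfer :
  ∀ {k l} (ι : Fin (suc k) → Fin (suc l)) (ρ : Fin (suc l) → Fin (suc k)) →
  (∀ a b → sub a b ≡ ρ (sub (ι a) (ι b))) →
  ∀ G → Colorable k G → Colorable l G
colorable-transfer ι ρ sub-reflect G (D , color) = D , λ φ →
  let c , proper = color (λ e → ρ (φ e))
  in (λ v → ι (c v)) , λ e conflict →
       proper e (trans (sub-reflect (c (head G D e)) (c (tail G D e))) (cong ρ conflict))

ℤ3↪ℤ5 : ℤ/ 3 → ℤ/ 5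
ℤ3↪ℤ5 zero = zero
ℤ3↪ℤ5 (suc zero) = suc zero
ℤ3↪ℤ5 (suc (suc zero)) = suc (suc zero)

-- 3 ≡ -2 and 4 ≡ -1 in ℤ₅ are sent to -2 ≡ 1 and -1 ≡ 2 in ℤ₃.
ℤ5→ℤ3 : ℤ/ 5 → ℤ/ 3
ℤ5→ℤ3 zero = zero
ℤ5→ℤ3 (suc zero) = suc zero
ℤ5→ℤ3 (suc (suc zero)) = suc (suc zero)
ℤ5→ℤ3 (suc (suc (suc zero))) = suc zero
ℤ5→ℤ3 (suc (suc (suc (suc zero)))) = suc (suc zero)

sub-ℤ3≡ℤ5→ℤ3-sub-ℤ5 : ∀ (a b : ℤ/ 3) → sub a b ≡ ℤ5→ℤ3 (sub (ℤ3↪ℤ5 a) (ℤ3↪ℤ5 b))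
sub-ℤ3≡ℤ5→ℤ3-sub-ℤ5 zero zero = refl
sub-ℤ3≡ℤ5→ℤ3-sub-ℤ5 zero (suc zero) = refl
sub-ℤ3≡ℤ5→ℤ3-sub-ℤ5 zero (suc (suc zero)) = refl
sub-ℤ3≡ℤ5→ℤ3-sub-ℤ5 (suc zero) zero = refl
sub-ℤ3≡ℤ5→ℤ3-sub-ℤ5 (suc zero) (suc zero) = refl
sub-ℤ3≡ℤ5→ℤ3-sub-ℤ5 (suc zero) (suc (suc zero)) = refl
sub-ℤ3≡ℤ5→ℤ3-sub-ℤ5 (suc (suc zero)) zero = refl
sub-ℤ3≡ℤ5→ℤ3-sub-ℤ5 (suc (suc zero)) (suc zero) = refl
sub-ℤ3≡ℤ5→ℤ3-sub-ℤ5 (suc (suc zero)) (suc (suc zero)) = refl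

proposition3 : (G : Graph) → Z3-colorable G → Z5-colorable G
proposition3 = colorable-transfer ℤ3↪ℤ5 ℤ5→ℤ3 sub-ℤ3≡ℤ5→ℤ3-sub-ℤ5
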